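{- Let $G$ be a finite, undirected, simple, connected graph with $n$ vertices that is $k$-regular, where $k\geq 1$. If $k$ is odd, then $G$ is $\left(\frac{nk}{2}-1\right)$-approximately magic. If $k$ is even, then $G$ is $k$-approximately magic.
   Context: For a graph with $m$ edges, a labeling is a bijection $f$ from the edge set to $\{1,\ldots,m\}$; the vertex sum at a vertex $v$ is the sum of $f(e)$ over all edges $e$ incident with $v$. A labeling is $\delta$-approximately magic if the difference between the largest and the smallest vertex sums is at most $\delta$. A graph is $\delta$-approximately magic if it admits a $\delta$-approximately magic labeling. -}

module Defs where

open import Data.Nat using (ℕ; suc; _+_; _≤_)
open import Data.Fin using (Fin; toℕ; _≟_)
open import Data.List using (List; map; allFin)
open import Data.Nat.ListAction using (sum)
open import Data.Bool using (Bool; _∨_; if_then_else_)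
open import Data.Product using (_×_; _,_; proj₁; proj₂; ∃-syntax)
open import Data.Sum using (_⊎_)
open import Relation.Binary.PropositionalEquality using (_≡_; _≢_)
open import Relation.Nullary.Decidable using (⌊_⌋)
open import Function.Bundles using (_⤖_; Bijection)

record Graph (n m : ℕ) : Set where
  field
    ends     : Fin m → Fin n × Fin n
    loopless : ∀ e → proj₁ (ends e) ≢ proj₂ (ends e)
    noMulti  : ∀ e e' →
      (ends e ≡ ends e' ⊎ ends e ≡ (proj₂ (ends e') , proj₁ (ends e'))) → e ≡ e'
open Graph public

incident : ∀ {n m} → Graph n m → Fin m → Fin n → Bool
incident G e v = ⌊ proj₁ (ends G e) ≟ v ⌋ ∨ ⌊ proj₂ (ends G e) ≟ v ⌋

Adj : ∀ {n m} → Graph n m → Fin n → Fin n → Set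
Adj G u v = ∃[ e ] (ends G e ≡ (u , v) ⊎ ends G e ≡ (v , u))

data Reach {n m} (G : Graph n m) : Fin n → Fin n → Set where
  here  : ∀ {u} → Reach G u u
  step  : ∀ {u v w} → Adj G u v → Reach G v w → Reach G u w

Connected : ∀ {n m} → Graph n m → Set
Connected G = ∀ u v → Reach G u v

degree : ∀ {n m} → Graph n m → Fin n → ℕ
degree {m = m} G v = sum (map (λ e → if incident G e v then 1 else 0) (allFin m))

Regular : ∀ {n m} → Graph n m → ℕ → Set
Regular G k = ∀ v → degree G v ≡ k

-- A labeling: a bijection from the edge set Fin m onto {1,…,m};
-- edge e gets label 1 + toℕ (f e).
Labeling : ℕ → Set
Labeling m = Fin m ⤖ Fin m

label : ∀ {m} → Labeling m → Fin m → ℕ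
label f e = suc (toℕ (Bijection.to f e))

vertexSum : ∀ {n m} → Graph n m → Labeling m → Fin n → ℕ
vertexSum {m = m} G f v =
  sum (map (λ e → if incident G e v then label f e else 0) (allFin m))

-- max vertex sum − min vertex sum ≤ δ
ApproxMagicLabeling : ∀ {n m} → Graph n m → ℕ → Labeling m → Set
ApproxMagicLabeling G δ f = ∀ u v → vertexSum G f u ≤ vertexSum G f v + δ

ApproxMagic : ∀ {n m} → Graph n m → ℕ → Set
ApproxMagic {m = m} G δ = ∃[ f ] ApproxMagicLabeling {m = m} G δ f

{-# OPTIONS --safe #-}
module Submission where

-- Label the edges of G in the order of an Euler circuit. The sum at a vertex v
-- is then the sum, over the passages of the circuit through v, of the labels of
-- the two consecutive edges of each passage.
--
-- For k = 2g the circuit passes g times through every vertex, and the labels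
-- 1, …, m are arranged around it so that any two cyclically consecutive ones add
-- up to m, m + 1 or m + 2; all vertex sums then lie between g m and g (m + 2).
--
-- For k = 2g + 1, n is even; adding a perfect matching of unlabelled virtual
-- edges makes all degrees even, and the Euler circuit of the new multigraph
-- passes g + 1 times through every vertex, exactly once along its virtual edge.
-- The real edges are labelled in circuit order by 1, m, 2, m − 1, …, so that
-- consecutive real labels add up to m + 1 or m + 2. Since m = k n / 2, some
-- virtual edge is followed by k real ones; starting the labelling there keeps
-- every label next to a virtual edge at most m − g, so all vertex sums lie
-- between g (m + 1) + 1 and g (m + 2) + m − g.

open import Defs
open import Data.Bool using (Bool; true; false; not; if_then_else_)
open import Data.Empty using (⊥; ⊥-elim)
open import Data.Maybe using (Maybe; just; nothing)
open import Data.Unit using (⊤; tt)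
open import Data.Fin as Fin using (Fin; toℕ; _↑ˡ_; _↑ʳ_)
open import Data.Fin.Properties
  using (_≟_; ↑ˡ-injective; ↑ʳ-injective; splitAt-↑ˡ; splitAt-↑ʳ; join-splitAt; toℕ-fromℕ<; toℕ<n; toℕ-injective;
         toℕ-cast; cast-involutive)
open import Data.Fin.Permutation as Perm using (Permutation; _⟨$⟩ʳ_; _⟨$⟩ˡ_; _∘ₚ_; flip; cast-id; inverseˡ)
open import Data.List using (List; []; _∷_; [_]; _++_; map; length; allFin; applyUpTo; catMaybes; mapMaybe; lookup)
open import Data.List.Properties
  using (∷-injective; length-map; catMaybes-++; length-applyUpTo; map-cong; map-∘; map-++; map-tabulate;
         ++-assoc; ++-identityʳ; length-++; length-tabulate; lookup-tabulate)
open import Data.List.Membership.Propositional using (_∈_; find; lose)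
open import Data.List.Membership.Propositional.Properties using (∈-map⁺; ∈-map⁻; ∈-++⁻; ∈-++⁺ˡ; ∈-++⁺ʳ; ∈-∃++; ∈-allFin)
open import Data.List.Relation.Unary.Any using (Any; here; there; any?)
open import Data.List.Relation.Unary.Linked as Linked using (Linked; []; [-]; _∷_)
open import Data.List.Relation.Unary.Linked.Properties using (map⁺; map⁻; applyUpTo⁺₁)
open import Data.List.Relation.Unary.All using (All; []; _∷_)
import Data.List.Relation.Unary.All.Properties as All
open import Data.List.Relation.Binary.Permutation.Propositional
  using (_↭_; ↭-refl; ↭-sym; ↭-trans; ↭-reflexive; ↭⇒↭ₛ; module PermutationReasoning)
open import Data.List.Relation.Binary.Permutation.Propositional.Properties
  using (∈-resp-↭; shift; ++-comm; ++⁺ʳ; ↭-length; mapMaybe-↭)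
  renaming (map⁺ to ↭-map⁺)
open import Data.Nat using (ℕ; zero; suc; _+_; _*_; _∸_; _⊓_; _≤_; _<_; _≤?_; z≤n; s≤s; s≤s⁻¹; ⌊_/2⌋)
open import Data.Nat.Properties hiding (_≟_)
open import Data.Nat.Properties using () renaming (_≟_ to _≟ℕ_)
open import Data.Nat.Divisibility using (_∣_; divides; ∣m∣n⇒∣m+n; ∣m+n∣m⇒∣n; ∣1⇒≡1; m∣m*n)
open import Data.Nat.Induction using (<-wellFounded)
open import Data.Nat.DivMod using (_/_; _%_; m≡m%n+[m/n]*n; m*n/n≡m)
open import Data.Nat.ListAction using (sum)
open import Data.Nat.ListAction.Properties using (sum-++; sum-↭)
open import Data.Nat.Tactic.RingSolver using (solve-∀)
open import Data.Product using (_×_; _,_; proj₁; proj₂; ∃-syntax)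
open import Data.Sum using (_⊎_; inj₁; inj₂; isInj₁; isInj₂)
open import Induction.WellFounded using (Acc; acc)
open import Relation.Nullary using (¬_; Dec; yes; no)
open import Relation.Nullary.Decidable using (⌊_⌋; _⊎-dec_)
import Data.List.Relation.Binary.Permutation.Setoid as Setoid↭
import Data.List.Relation.Binary.Permutation.Setoid.Properties as Setoid↭ₚ
open import Relation.Binary.Definitions using (tri<; tri≈; tri>)
open import Relation.Binary.PropositionalEquality
  using (setoid; _≡_; _≢_; refl; sym; trans; cong; cong₂; subst; subst₂; module ≡-Reasoning)
open import Function using (_∘_; id)
open import Function.Properties.Inverse using (↔⇒⤖)

-- Sums and lists

∑ : {A : Set} → List A → (A → ℕ) → ℕ
∑ xs f = sum (map f xs)

infix 5 ∑
syntax ∑ xs (λ x → e) = ∑[ x ∈ xs ] e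

private variable
  A B : Set

∑-cong : ∀ xs {f g : A → ℕ} → (∀ x → f x ≡ g x) → ∑ xs f ≡ ∑ xs g
∑-cong xs f≗g = cong sum (map-cong f≗g xs)

∑-++ : ∀ xs ys (f : A → ℕ) → ∑ (xs ++ ys) f ≡ ∑ xs f + ∑ ys f
∑-++ xs ys f = trans (cong sum (map-++ f xs ys)) (sum-++ (map f xs) (map f ys))

∑-↭ : ∀ {xs ys} (f : A → ℕ) → xs ↭ ys → ∑ xs f ≡ ∑ ys f
∑-↭ f p = sum-↭ (↭-map⁺ f p)

∑-map : ∀ (g : B → A) xs (f : A → ℕ) → ∑ (map g xs) f ≡ ∑[ x ∈ xs ] f (g x)
∑-map g [] f = refl
∑-map g (x ∷ xs) f = cong (f (g x) +_) (∑-map g xs f)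

∑-+ : ∀ xs (f g : A → ℕ) → (∑[ x ∈ xs ] (f x + g x)) ≡ ∑ xs f + ∑ xs g
∑-+ [] f g = refl
∑-+ (x ∷ xs) f g = trans (cong (f x + g x +_) (∑-+ xs f g)) (interchange (f x) (g x) _ _)
  where
  interchange : ∀ a b c d → a + b + (c + d) ≡ a + c + (b + d)
  interchange = solve-∀

∑-const : ∀ (xs : List A) c → (∑[ x ∈ xs ] c) ≡ length xs * c
∑-const [] c = refl
∑-const (x ∷ xs) c = cong (c +_) (∑-const xs c)

∑-zero : ∀ (xs : List A) → (∑[ x ∈ xs ] 0) ≡ 0
∑-zero xs = trans (∑-const xs 0) (*-zeroʳ (length xs))

∑-comm : ∀ xs (ys : List B) (F : A → B → ℕ) →
  (∑[ x ∈ xs ] ∑[ y ∈ ys ] F x y) ≡ (∑[ y ∈ ys ] ∑[ x ∈ xs ] F x y)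
∑-comm [] ys F = sym (∑-zero ys)
∑-comm (x ∷ xs) ys F = trans (cong (∑ ys (F x) +_) (∑-comm xs ys F)) (sym (∑-+ ys (F x) _))

length-allFin : ∀ n → length (allFin n) ≡ n
length-allFin n = length-tabulate id

∑-allFin-const : ∀ n c → (∑[ i ∈ allFin n ] c) ≡ n * c
∑-allFin-const n c = trans (∑-const (allFin n) c) (cong (_* c) (length-allFin n))

∑-allFin-suc : ∀ {n} (f : Fin (suc n) → ℕ) → ∑ (allFin (suc n)) f ≡ f Fin.zero + (∑[ i ∈ allFin n ] f (Fin.suc i))
∑-allFin-suc {n} f = cong (f Fin.zero +_) (cong sum (trans (map-tabulate Fin.suc f) (sym (map-tabulate id (λ i → f (Fin.suc i))))))

δ : ∀ {n} → Fin n → Fin n → ℕ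
δ u v = if ⌊ u ≟ v ⌋ then 1 else 0

δ-refl : ∀ {n} (v : Fin n) → δ v v ≡ 1
δ-refl v with v ≟ v
... | yes _ = refl
... | no v≢v = ⊥-elim (v≢v refl)

δ-≢ : ∀ {n} {u v : Fin n} → u ≢ v → δ u v ≡ 0
δ-≢ {u = u} {v} u≢v with u ≟ v
... | yes u≡v = ⊥-elim (u≢v u≡v)
... | no _ = refl

δ-suc : ∀ {n} (u v : Fin n) → δ (Fin.suc u) (Fin.suc v) ≡ δ u v
δ-suc u v with u ≟ v
... | yes refl = refl
... | no _ = refl

∑-δ : ∀ {n} (u : Fin n) → (∑[ v ∈ allFin n ] δ u v) ≡ 1
∑-δ {suc n} Fin.zero = trans (∑-allFin-suc {n} (δ Fin.zero)) (cong suc (∑-zero (allFin n)))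
∑-δ {suc n} (Fin.suc u) = trans (∑-allFin-suc (δ (Fin.suc u))) (trans (∑-cong (allFin n) (δ-suc u)) (∑-δ u))

δ-sym : ∀ {n} (u v : Fin n) → δ u v ≡ δ v u
δ-sym u v with u ≟ v
... | yes refl = sym (δ-refl u)
... | no u≢v   = sym (δ-≢ (u≢v ∘ sym))

δ-injective : ∀ {h n} {f : Fin h → Fin n} → (∀ {i j} → f i ≡ f j → i ≡ j) → ∀ u v → δ (f u) (f v) ≡ δ u v
δ-injective {f = f} inj u v with u ≟ v
... | yes refl = δ-refl (f u)
... | no u≢v   = δ-≢ (u≢v ∘ inj)

applyUpTo-++ : ∀ (f : ℕ → A) a b → applyUpTo f (a + b) ≡ applyUpTo f a ++ applyUpTo (f ∘ (a +_)) b
applyUpTo-++ f zero    b = refl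
applyUpTo-++ f (suc a) b = cong (f 0 ∷_) (applyUpTo-++ (f ∘ suc) a b)

++-injective-length : ∀ (xs ys : List A) {zs ws} → length xs ≡ length ys → xs ++ zs ≡ ys ++ ws → xs ≡ ys × zs ≡ ws
++-injective-length []       []       _   eq = refl , eq
++-injective-length (x ∷ xs) (y ∷ ys) len eq with ∷-injective eq
... | refl , eq′ with ++-injective-length xs ys (suc-injective len) eq′
...   | refl , rest = refl , rest

cyclic : List A → List A
cyclic []       = []
cyclic (x ∷ xs) = x ∷ xs ++ [ x ]

map-cyclic : ∀ (f : A → B) xs → map f (cyclic xs) ≡ cyclic (map f xs)
map-cyclic f []       = refl
map-cyclic f (x ∷ xs) = cong (f x ∷_) (map-++ f xs [ x ])

length-∷ʳ : ∀ (xs : List A) {x} → length (xs ++ [ x ]) ≡ suc (length xs)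
length-∷ʳ xs = trans (length-++ xs) (+-comm (length xs) 1)

linked-applyUpTo-∷ʳ : ∀ {R : ℕ → ℕ → Set} f j x → Linked R (applyUpTo f (suc j)) → R (f j) x → Linked R (applyUpTo f (suc j) ++ [ x ])
linked-applyUpTo-∷ʳ f zero    x _          r = r ∷ [-]
linked-applyUpTo-∷ʳ f (suc j) x (r′ ∷ rs)  r = r′ ∷ linked-applyUpTo-∷ʳ (f ∘ suc) j x rs r

-- Multigraphs, walks and Euler circuits

module Multigraph {n : ℕ} {Edge : Set} (ends : Edge → Fin n × Fin n) where

  Dart : Set
  Dart = Edge × Bool

  edge : Dart → Edge
  edge = proj₁

  tail head : Dart → Fin n
  tail (e , false) = proj₁ (ends e)
  tail (e , true)  = proj₂ (ends e)
  head (e , false) = proj₂ (ends e)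
  head (e , true)  = proj₁ (ends e)

  incidence : Edge → Fin n → ℕ
  incidence e v = δ (proj₁ (ends e)) v + δ (proj₂ (ends e)) v

  incidence-dart : ∀ d v → incidence (edge d) v ≡ δ (tail d) v + δ (head d) v
  incidence-dart (e , false) v = refl
  incidence-dart (e , true)  v = +-comm (δ (proj₁ (ends e)) v) (δ (proj₂ (ends e)) v)

  data Walk : Fin n → List Dart → Fin n → Set where
    []   : ∀ {a} → Walk a [] a
    step : ∀ {a b} d {ds} → tail d ≡ a → Walk (head d) ds b → Walk a (d ∷ ds) b

  _++ʷ_ : ∀ {a b c xs ys} → Walk a xs b → Walk b ys c → Walk a (xs ++ ys) c
  []           ++ʷ w₂ = w₂
  step d eq w₁ ++ʷ w₂ = step d eq (w₁ ++ʷ w₂)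

  splitʷ : ∀ {a c} xs {ys} → Walk a (xs ++ ys) c → ∃[ b ] (Walk a xs b × Walk b ys c)
  splitʷ []       w               = _ , [] , w
  splitʷ (x ∷ xs) (step .x eq w) with splitʷ xs w
  ... | b , w₁ , w₂ = b , step x eq w₁ , w₂

  rotate : ∀ {a} xs {ys} → Walk a (xs ++ ys) a → ∃[ b ] Walk b (ys ++ xs) b
  rotate xs w with splitʷ xs w
  ... | b , w₁ , w₂ = b , w₂ ++ʷ w₁

  walkDegree : List Dart → Fin n → ℕ
  walkDegree ds v = ∑[ d ∈ ds ] incidence (edge d) v

  parity : ∀ {a ds b} → Walk a ds b → ∀ v → 2 ∣ δ a v + walkDegree ds v + δ b v
  parity {a} [] v = subst (2 ∣_) (double (δ a v)) (m∣m*n (δ a v))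
    where
    double : ∀ x → 2 * x ≡ x + 0 + x
    double = solve-∀
  parity {b = b} (step d {ds} refl w) v =
    subst (2 ∣_) (trans (regroup (δ (tail d) v) (δ (head d) v) (walkDegree ds v) (δ b v))
                        (cong (λ i → δ (tail d) v + (i + walkDegree ds v) + δ b v) (sym (incidence-dart d v))))
      (∣m∣n⇒∣m+n (m∣m*n (δ (tail d) v)) (parity w v))
    where
    regroup : ∀ t h W e → 2 * t + (h + W + e) ≡ t + (t + h + W) + e
    regroup = solve-∀

  Meets : Fin n → Edge → Set
  Meets v e = proj₁ (ends e) ≡ v ⊎ proj₂ (ends e) ≡ v

  meets? : ∀ v e → Dec (Meets v e)
  meets? v e = (proj₁ (ends e) ≟ v) ⊎-dec (proj₂ (ends e) ≟ v)

  dart-into : ∀ {v e} → Meets v e → ∃[ d ] (edge d ≡ e × head d ≡ v)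
  dart-into {e = e} (inj₁ eq) = (e , true)  , refl , eq
  dart-into {e = e} (inj₂ eq) = (e , false) , refl , eq

  tail-meets : ∀ d → Meets (tail d) (edge d)
  tail-meets (e , false) = inj₁ refl
  tail-meets (e , true)  = inj₂ refl

  head-endpoint : ∀ {c d} → edge c ≡ edge d → head c ≡ tail d ⊎ head c ≡ head d
  head-endpoint {_ , false} {_ , false} refl = inj₂ refl
  head-endpoint {_ , false} {_ , true}  refl = inj₁ refl
  head-endpoint {_ , true}  {_ , false} refl = inj₁ refl
  head-endpoint {_ , true}  {_ , true}  refl = inj₂ refl

  ∑-incidence-none : ∀ {v} us → ¬ Any (Meets v) us → (∑[ e ∈ us ] incidence e v) ≡ 0
  ∑-incidence-none []       none = refl
  ∑-incidence-none (e ∷ us) none =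
    cong₂ _+_ (cong₂ _+_ (δ-≢ (λ eq → none (here (inj₁ eq)))) (δ-≢ (λ eq → none (here (inj₂ eq)))))
              (∑-incidence-none us (λ found → none (there found)))

  head-visited : ∀ {a ds b d} → Walk a ds b → d ∈ ds → head d ∈ b ∷ map tail ds
  head-visited (step d refl [])              (here refl) = here refl
  head-visited (step d refl (step _ eq _))   (here refl) = there (there (here (sym eq)))
  head-visited (step _ refl w)               (there d∈) with head-visited w d∈
  ... | here eq = here eq
  ... | there p = there (there p)

  rotate-to : ∀ {a ds v} → Walk a ds a → v ∈ a ∷ map tail ds → ∃[ ds′ ] (Walk v ds′ v × ds′ ↭ ds)
  rotate-to {ds = ds} w (here refl) = ds , w , ↭-refl
  rotate-to w (there v∈) with ∈-map⁻ tail v∈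
  ... | d , d∈ , refl with ∈-∃++ d∈
  ...   | xs , ys , refl with rotate xs w
  ...     | _ , w′@(step _ refl _) = (d ∷ ys) ++ xs , w′ , ++-comm (d ∷ ys) xs

  module Euler (edges : List Edge) (∈-edges : ∀ e → e ∈ edges) where

    multidegree : Fin n → ℕ
    multidegree v = ∑[ e ∈ edges ] incidence e v

    Unused : List Dart → List Edge → Set
    Unused ds us = map edge ds ++ us ↭ edges

    EulerCircuit : Set
    EulerCircuit = ∃[ a ] ∃[ ds ] (Walk a ds a × map edge ds ↭ edges)

    multidegree-split : ∀ {ds us} → Unused ds us → ∀ v →
      multidegree v ≡ walkDegree ds v + (∑[ e ∈ us ] incidence e v)
    multidegree-split {ds} {us} p v = begin
      multidegree v                                        ≡⟨ ∑-↭ (λ e → incidence e v) p ⟨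
      ∑[ e ∈ map edge ds ++ us ] incidence e v             ≡⟨ ∑-++ (map edge ds) us (λ e → incidence e v) ⟩
      (∑[ e ∈ map edge ds ] incidence e v) + (∑[ e ∈ us ] incidence e v)
        ≡⟨ cong (_+ _) (∑-map edge ds (λ e → incidence e v)) ⟩
      walkDegree ds v + (∑[ e ∈ us ] incidence e v)        ∎
      where open ≡-Reasoning

    extend : ∀ {a ds b us} → Walk a ds b → Unused ds us → Any (Meets a) us →
      ∃[ us′ ] (length us′ < length us × ∃[ d ] (Walk (tail d) (d ∷ ds) b × Unused (d ∷ ds) us′))
    extend {ds = ds} w p found with find found
    ... | e , e∈us , meets with ∈-∃++ e∈us | dart-into meets
    ...   | xs , ys , refl | d , refl , refl = xs ++ ys , shorter , d , step d refl w , unused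
      where
      shorter : length (xs ++ ys) < length (xs ++ edge d ∷ ys)
      shorter = subst₂ _<_ (sym (length-++ xs)) (sym (length-++ xs)) (+-monoʳ-< (length xs) (n<1+n _))
      unused : edge d ∷ map edge ds ++ xs ++ ys ↭ edges
      unused = begin
        edge d ∷ map edge ds ++ xs ++ ys      ≡⟨ cong (edge d ∷_) (++-assoc (map edge ds) xs ys) ⟨
        edge d ∷ (map edge ds ++ xs) ++ ys    ↭⟨ shift (edge d) (map edge ds ++ xs) ys ⟨
        (map edge ds ++ xs) ++ edge d ∷ ys    ≡⟨ ++-assoc (map edge ds) xs (edge d ∷ ys) ⟩
        map edge ds ++ xs ++ edge d ∷ ys      ↭⟨ p ⟩
        edges                                 ∎
        where open PermutationReasoning

    2∤1 : ¬ (2 ∣ 1)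
    2∤1 2∣1 with ∣1⇒≡1 2∣1
    ... | ()

    closed-if-stuck : (∀ v → 2 ∣ multidegree v) → ∀ {a ds b us} →
      Walk a ds b → Unused ds us → ¬ Any (Meets a) us → a ≡ b
    closed-if-stuck even {a} {ds} {b} {us} w p none with a ≟ b
    ... | yes a≡b = a≡b
    ... | no a≢b = ⊥-elim (2∤1 (∣m+n∣m⇒∣n odd-at-a even-at-a))
      where
      -- the walk meets a an odd number of times, yet every edge at a is already used
      odd-at-a : 2 ∣ walkDegree ds a + 1
      odd-at-a = subst (2 ∣_) (trans (cong₂ (λ i j → i + walkDegree ds a + j) (δ-refl a) (δ-≢ (a≢b ∘ sym))) reorder) (parity w a)
        where
        reorder : 1 + walkDegree ds a + 0 ≡ walkDegree ds a + 1
        reorder = trans (+-identityʳ _) (+-comm 1 _)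
      even-at-a : 2 ∣ walkDegree ds a
      even-at-a = subst (2 ∣_) (trans (multidegree-split {ds} {us} p a) (trans (cong (walkDegree ds a +_) (∑-incidence-none us none)) (+-identityʳ _))) (even a)

    module _ (connected : ∀ u v → ∃[ qs ] Walk u qs v) (even : ∀ v → 2 ∣ multidegree v) where

      -- the edge of c is not unused, hence an edge of the circuit
      lands-visited : ∀ {a ds us} → Walk a ds a → Unused ds us → ∀ c →
        ¬ Any (Meets (tail c)) us → head c ∈ a ∷ map tail ds
      lands-visited {a} {ds} w p c none with ∈-++⁻ (map edge ds) (∈-resp-↭ (↭-sym p) (∈-edges (edge c)))
      ... | inj₂ c∈us = ⊥-elim (none (lose c∈us (tail-meets c)))
      ... | inj₁ c∈ds with ∈-map⁻ edge c∈ds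
      ...   | d , d∈ , same with head-endpoint {c} {d} same
      ...     | inj₁ eq = there (subst (_∈ map tail ds) (sym eq) (∈-map⁺ tail d∈))
      ...     | inj₂ eq = subst (_∈ a ∷ map tail ds) (sym eq) (head-visited w d∈)

      frontier : ∀ {a ds us u qs p} → Walk a ds a → Unused ds us → Walk u qs p →
        u ∈ a ∷ map tail ds → Any (Meets p) us → ∃[ v ] (v ∈ a ∷ map tail ds × Any (Meets v) us)
      frontier w p [] u∈ found = _ , u∈ , found
      frontier {us = us} {u} w p (step c refl qs) u∈ found with any? (meets? u) us
      ... | yes at-u = u , u∈ , at-u
      ... | no none  = frontier w p qs (lands-visited w p c none) found

      grow : ∀ {a ds b} us → Acc _<_ (length us) → Walk a ds b → Unused ds us → EulerCircuit
      grow {a} us (acc rec) w p with any? (meets? a) us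
      ... | yes found with extend w p found
      ...   | us′ , lt , _ , w′ , p′ = grow us′ (rec lt) w′ p′
      grow {a} us (acc rec) w p | no none with closed-if-stuck even w p none
      grow {a} {ds} []       (acc rec) w p | no none | refl = a , ds , w , subst (_↭ _) (++-identityʳ _) p
      grow {a} {ds} (e ∷ us) (acc rec) w p | no none | refl
        with frontier w p (proj₂ (connected a (proj₁ (ends e)))) (here refl) (here (inj₁ refl))
      ... | v , v∈ , found with rotate-to w v∈
      ...   | ds′ , w′ , ds′↭ds with extend w′ (↭-trans (++⁺ʳ (e ∷ us) (↭-map⁺ edge ds′↭ds)) p) found
      ...     | us′ , lt , _ , w″ , p″ = grow us′ (rec lt) w″ p″

      euler : Fin n → EulerCircuit
      euler a₀ = grow edges (<-wellFounded (length edges)) ([] {a₀}) ↭-refl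

  -- the joints of a list of darts are its consecutive pairs x , y; such a joint lies at head x
  jointSum : Fin n → (Dart → Dart → ℕ) → List Dart → ℕ
  jointSum v W (x ∷ y ∷ zs) = δ (head x) v * W x y + jointSum v W (y ∷ zs)
  jointSum v W _            = 0

  jointSum-cong : ∀ v {W W′} ds → (∀ x y → W x y ≡ W′ x y) → jointSum v W ds ≡ jointSum v W′ ds
  jointSum-cong v []           W≗W′ = refl
  jointSum-cong v (x ∷ [])     W≗W′ = refl
  jointSum-cong v (x ∷ y ∷ zs) W≗W′ = cong₂ (λ i j → δ (head x) v * i + j) (W≗W′ x y) (jointSum-cong v (y ∷ zs) W≗W′)

  jointSum-+ : ∀ v W W′ ds → jointSum v (λ x y → W x y + W′ x y) ds ≡ jointSum v W ds + jointSum v W′ ds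
  jointSum-+ v W W′ []           = refl
  jointSum-+ v W W′ (x ∷ [])     = refl
  jointSum-+ v W W′ (x ∷ y ∷ zs) =
    trans (cong (δ (head x) v * (W x y + W′ x y) +_) (jointSum-+ v W W′ (y ∷ zs)))
          (distribute (δ (head x) v) (W x y) (W′ x y) _ _)
    where
    distribute : ∀ d a b s t → d * (a + b) + (s + t) ≡ d * a + s + (d * b + t)
    distribute = solve-∀

  jointSum-* : ∀ v c W ds → jointSum v (λ x y → c * W x y) ds ≡ c * jointSum v W ds
  jointSum-* v c W []           = sym (*-zeroʳ c)
  jointSum-* v c W (x ∷ [])     = sym (*-zeroʳ c)
  jointSum-* v c W (x ∷ y ∷ zs) =
    trans (cong (δ (head x) v * (c * W x y) +_) (jointSum-* v c W (y ∷ zs)))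
          (factor (δ (head x) v) c (W x y) _)
    where
    factor : ∀ d c a s → d * (c * a) + c * s ≡ c * (d * a + s)
    factor = solve-∀

  jointSum-mono : ∀ v {W W′ ds} → Linked (λ x y → W x y ≤ W′ x y) ds → jointSum v W ds ≤ jointSum v W′ ds
  jointSum-mono v []                   = z≤n
  jointSum-mono v [-]                  = z≤n
  jointSum-mono v (_∷_ {x = x} le les) = +-mono-≤ (*-monoʳ-≤ (δ (head x) v) le) (jointSum-mono v les)

  -- Each dart y contributes φ y to the joint it leaves and to the joint it enters.
  jointSum-walk : ∀ (φ : Dart → ℕ) v {a x xs b} (c : Dart) → Walk a (x ∷ xs) b →
    jointSum v (λ y z → φ y + φ z) (x ∷ xs ++ [ c ]) + δ a v * φ x ≡
    (∑[ y ∈ (x ∷ xs) ] incidence (edge y) v * φ y) + δ b v * φ c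
  jointSum-walk φ v c (step x refl []) = begin
    δ (head x) v * (φ x + φ c) + 0 + δ (tail x) v * φ x
      ≡⟨ regroup (δ (tail x) v) (δ (head x) v) (φ x) (φ c) ⟩
    (δ (tail x) v + δ (head x) v) * φ x + 0 + δ (head x) v * φ c
      ≡⟨ cong (λ i → i * φ x + 0 + δ (head x) v * φ c) (sym (incidence-dart x v)) ⟩
    incidence (edge x) v * φ x + 0 + δ (head x) v * φ c ∎
    where
    open ≡-Reasoning
    regroup : ∀ t h p q → h * (p + q) + 0 + t * p ≡ (t + h) * p + 0 + h * q
    regroup = solve-∀
  jointSum-walk φ v {xs = y ∷ ys} {b} c (step x refl w) = begin
    δ (head x) v * (φ x + φ y) + J + δ (tail x) v * φ x
      ≡⟨ regroup (δ (tail x) v) (δ (head x) v) (φ x) (φ y) J ⟩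
    (δ (tail x) v + δ (head x) v) * φ x + (J + δ (head x) v * φ y)
      ≡⟨ cong₂ (λ i j → i * φ x + j) (sym (incidence-dart x v)) (jointSum-walk φ v c w) ⟩
    incidence (edge x) v * φ x + ((∑[ z ∈ (y ∷ ys) ] incidence (edge z) v * φ z) + δ b v * φ c)
      ≡⟨ sym (+-assoc (incidence (edge x) v * φ x) _ _) ⟩
    (∑[ z ∈ (x ∷ y ∷ ys) ] incidence (edge z) v * φ z) + δ b v * φ c ∎
    where
    open ≡-Reasoning
    J : ℕ
    J = jointSum v (λ y z → φ y + φ z) (y ∷ ys ++ [ c ])
    regroup : ∀ t h p q j → h * (p + q) + j + t * p ≡ (t + h) * p + (j + h * q)
    regroup = solve-∀

  jointSum-closed : ∀ (φ : Dart → ℕ) v {a ds} → Walk a ds a →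
    jointSum v (λ y z → φ y + φ z) (cyclic ds) ≡ ∑[ y ∈ ds ] incidence (edge y) v * φ y
  jointSum-closed φ v []                = refl
  jointSum-closed φ v w@(step x refl _) = +-cancelʳ-≡ _ _ _ (jointSum-walk φ v x w)

-- Labellings along a list

record Arrangement (m : ℕ) : Set where
  field
    value           : ℕ → ℕ
    permutation     : Permutation m m
    toℕ-permutation : ∀ i → toℕ (permutation ⟨$⟩ʳ i) ≡ value (toℕ i)

arrangement : ∀ {top} (f f⁻¹ : ℕ → ℕ) →
  (∀ {r} → r ≤ top → f r ≤ top) → (∀ {r} → r ≤ top → f⁻¹ r ≤ top) →
  (∀ {r} → r ≤ top → f⁻¹ (f r) ≡ r) → (∀ {r} → r ≤ top → f (f⁻¹ r) ≡ r) → Arrangement (suc top)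
arrangement {top} f f⁻¹ f≤ f⁻¹≤ f⁻¹∘f f∘f⁻¹ = record
  { value           = f
  ; permutation     = Perm.permutation (onFin f f≤) (onFin f⁻¹ f⁻¹≤) (inverse f f≤ f⁻¹ f⁻¹≤ f∘f⁻¹) (inverse f⁻¹ f⁻¹≤ f f≤ f⁻¹∘f)
  ; toℕ-permutation = λ i → toℕ-fromℕ< _
  }
  where
  Bounded : (ℕ → ℕ) → Set
  Bounded g = ∀ {r} → r ≤ top → g r ≤ top
  onFin : (g : ℕ → ℕ) → Bounded g → Fin (suc top) → Fin (suc top)
  onFin g g≤ i = Fin.fromℕ< (s≤s (g≤ (s≤s⁻¹ (toℕ<n i))))
  inverse : ∀ g (g≤ : Bounded g) g′ (g′≤ : Bounded g′) → (∀ {r} → r ≤ top → g (g′ r) ≡ r) → ∀ i → onFin g g≤ (onFin g′ g′≤ i) ≡ i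
  inverse g g≤ g′ g′≤ g∘g′ i = toℕ-injective (begin
    toℕ (onFin g g≤ (onFin g′ g′≤ i)) ≡⟨ toℕ-fromℕ< _ ⟩
    g (toℕ (onFin g′ g′≤ i))          ≡⟨ cong g (toℕ-fromℕ< _) ⟩
    g (g′ (toℕ i))                    ≡⟨ g∘g′ (s≤s⁻¹ (toℕ<n i)) ⟩
    toℕ i                             ∎)
    where open ≡-Reasoning

map-≡-applyUpTo : ∀ (g : A → B) h xs → (∀ i → g (lookup xs i) ≡ h (toℕ i)) → map g xs ≡ applyUpTo h (length xs)
map-≡-applyUpTo g h []       eq = refl
map-≡-applyUpTo g h (x ∷ xs) eq = cong₂ _∷_ (eq Fin.zero) (map-≡-applyUpTo g (h ∘ suc) xs (eq ∘ Fin.suc))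

module _ {m} {es : List (Fin m)} (es↭ : es ↭ allFin m) (A : Arrangement m) where
  open Arrangement A

  private
    length-es : length es ≡ m
    length-es = trans (↭-length es↭) (length-allFin m)

    positions : Permutation (length es) m
    positions = Setoid↭.onIndices (↭⇒↭ₛ es↭) ∘ₚ cast-id (length-allFin m)

    lookup-positions : ∀ i → lookup es i ≡ positions ⟨$⟩ʳ i
    lookup-positions i = trans (Setoid↭ₚ.onIndices-lookup (setoid (Fin m)) (↭⇒↭ₛ es↭) i) (lookup-allFin _)
      where
      lookup-allFin : ∀ j → lookup (allFin m) j ≡ Fin.cast (length-allFin m) j
      lookup-allFin j = trans (cong (lookup (allFin m)) (sym (cast-involutive {m = m} {n = length (allFin m)} (sym (length-allFin m)) (length-allFin m) j)))
                              (lookup-tabulate id (Fin.cast (length-allFin m) j))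

  -- gives the i-th edge of es the label 1 + value i
  labelling : Labeling m
  labelling = ↔⇒⤖ (flip positions ∘ₚ cast-id length-es ∘ₚ permutation)

  labels-along : map (label labelling) es ≡ applyUpTo (suc ∘ value) m
  labels-along = trans (map-≡-applyUpTo (label labelling) (suc ∘ value) es label-lookup) (cong (applyUpTo (suc ∘ value)) length-es)
    where
    label-lookup : ∀ i → label labelling (lookup es i) ≡ suc (value (toℕ i))
    label-lookup i = cong suc (begin
      toℕ (permutation ⟨$⟩ʳ Fin.cast length-es (positions ⟨$⟩ˡ lookup es i))
        ≡⟨ cong (λ j → toℕ (permutation ⟨$⟩ʳ Fin.cast length-es (positions ⟨$⟩ˡ j))) (lookup-positions i) ⟩
      toℕ (permutation ⟨$⟩ʳ Fin.cast length-es (positions ⟨$⟩ˡ (positions ⟨$⟩ʳ i)))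
        ≡⟨ cong (λ j → toℕ (permutation ⟨$⟩ʳ Fin.cast length-es j)) (inverseˡ positions) ⟩
      toℕ (permutation ⟨$⟩ʳ Fin.cast length-es i)
        ≡⟨ toℕ-permutation _ ⟩
      value (toℕ (Fin.cast length-es i))
        ≡⟨ cong value (toℕ-cast length-es i) ⟩
      value (toℕ i) ∎)
      where open ≡-Reasoning

-- Two arrangements of labels

Between : ℕ → ℕ → ℕ → Set
Between lo hi x = lo ≤ x × x ≤ hi

between-suc² : ∀ {lo hi x y} → Between lo hi (x + y) → Between (suc (suc lo)) (suc (suc hi)) (suc x + suc y)
between-suc² {x = x} {y} (lo , hi) = subst (Between _ _) (sym (cong suc (+-suc x y))) (s≤s (s≤s lo) , s≤s (s≤s hi))

odd? : ℕ → Bool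
odd? zero    = false
odd? (suc r) = not (odd? r)

odd?-double : ∀ q → odd? (q + q) ≡ false
odd?-double zero    = refl
odd?-double (suc q) rewrite +-suc q q | odd?-double q = refl

data Parity : ℕ → Set where
  even : ∀ q → Parity (q + q)
  odd  : ∀ q → Parity (suc (q + q))

parity : ∀ r → Parity r
parity zero = even 0
parity (suc r) with parity r
... | even q = odd q
... | odd q  = subst Parity (cong suc (+-suc q q)) (even (suc q))

half-sum : ∀ a b {c} → a + a ≤ c → b + b ≤ c → a + b ≤ c
half-sum a b a+a≤c b+b≤c with ≤-total a b
... | inj₁ a≤b = ≤-trans (+-monoˡ-≤ b a≤b) b+b≤c
... | inj₂ b≤a = ≤-trans (+-monoʳ-≤ a b≤a) a+a≤c

-- The arrangement 0, top, 1, top ∸ 1, 2, … : neighbours add up to top or top + 1.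
module Zigzag (top : ℕ) where

  zig : ℕ → ℕ
  zig r = if odd? r then top ∸ ⌊ r /2⌋ else ⌊ r /2⌋

  zig-even : ∀ q → zig (q + q) ≡ q
  zig-even q rewrite odd?-double q = sym (n≡⌊n+n/2⌋ q)

  zig-odd : ∀ q → zig (suc (q + q)) ≡ top ∸ q
  zig-odd q rewrite odd?-double q = cong (top ∸_) (sym (n≡⌈n+n/2⌉ q))

  unzig : ℕ → ℕ
  unzig t = if ⌊ t + t ≤? top ⌋ then t + t else suc ((top ∸ t) + (top ∸ t))

  unzig-low : ∀ t → t + t ≤ top → unzig t ≡ t + t
  unzig-low t le with t + t ≤? top
  ... | yes _  = refl
  ... | no  gt = ⊥-elim (gt le)

  unzig-high : ∀ t → top < t + t → unzig t ≡ suc ((top ∸ t) + (top ∸ t))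
  unzig-high t lt with t + t ≤? top
  ... | yes le = ⊥-elim (<⇒≱ lt le)
  ... | no  _  = refl

  zig≤ : ∀ {r} → r ≤ top → zig r ≤ top
  zig≤ {r} r≤ with parity r
  ... | even q = subst (_≤ top) (sym (zig-even q)) (≤-trans (m≤m+n q q) r≤)
  ... | odd q  = subst (_≤ top) (sym (zig-odd q)) (m∸n≤m top q)

  unzig≤ : ∀ {t} → t ≤ top → unzig t ≤ top
  unzig≤ {t} t≤ with t + t ≤? top
  ... | yes le = le
  ... | no  gt = subst (suc ((top ∸ t) + (top ∸ t)) ≤_) (m+[n∸m]≡n t≤) (+-monoˡ-< (top ∸ t) complement<t)
    where
    complement<t : top ∸ t < t
    complement<t = +-cancelˡ-< t (top ∸ t) t (subst (_< t + t) (sym (m+[n∸m]≡n t≤)) (≰⇒> gt))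

  unzig∘zig : ∀ {r} → r ≤ top → unzig (zig r) ≡ r
  unzig∘zig {r} r≤ with parity r
  ... | even q = trans (cong unzig (zig-even q)) (unzig-low q r≤)
  ... | odd q  = begin
    unzig (zig (suc (q + q)))                          ≡⟨ cong unzig (zig-odd q) ⟩
    unzig (top ∸ q)                                    ≡⟨ unzig-high (top ∸ q) ∸-double-high ⟩
    suc ((top ∸ (top ∸ q)) + (top ∸ (top ∸ q)))        ≡⟨ cong (λ x → suc (x + x)) (m∸[m∸n]≡n q≤) ⟩
    suc (q + q)                                        ∎
    where
    open ≡-Reasoning
    q≤ : q ≤ top
    q≤ = ≤-trans (m≤m+n q q) (≤-trans (n≤1+n _) r≤)
    top≡ : q + (top ∸ q) ≡ top
    top≡ = m+[n∸m]≡n q≤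
    ∸-double-high : top < (top ∸ q) + (top ∸ q)
    ∸-double-high = subst (_< (top ∸ q) + (top ∸ q)) top≡
      (+-monoˡ-< (top ∸ q) (+-cancelˡ-< q q (top ∸ q) (subst (q + q <_) (sym top≡) r≤)))

  zig∘unzig : ∀ {t} → t ≤ top → zig (unzig t) ≡ t
  zig∘unzig {t} t≤ with t + t ≤? top
  ... | yes _ = zig-even t
  ... | no  _ = trans (zig-odd (top ∸ t)) (m∸[m∸n]≡n t≤)

  zigzag : Arrangement (suc top)
  zigzag = arrangement zig unzig zig≤ unzig≤ unzig∘zig zig∘unzig

  zig-neighbours : ∀ {r} → suc r ≤ top → Between (suc (suc top)) (suc (suc (suc top))) (suc (zig r) + suc (zig (suc r)))
  zig-neighbours {r} r<top with parity r
  ... | even q = subst (Between _ _) (sym total) (≤-refl , n≤1+n _)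
    where
    open ≡-Reasoning
    total : suc (zig (q + q)) + suc (zig (suc (q + q))) ≡ suc (suc top)
    total = begin
      suc (zig (q + q)) + suc (zig (suc (q + q))) ≡⟨ cong₂ (λ x y → suc x + suc y) (zig-even q) (zig-odd q) ⟩
      suc q + suc (top ∸ q)                       ≡⟨ cong suc (+-suc q (top ∸ q)) ⟩
      suc (suc (q + (top ∸ q)))                   ≡⟨ cong (suc ∘ suc) (m+[n∸m]≡n (≤-trans (m≤m+n q q) (≤-trans (n≤1+n _) r<top))) ⟩
      suc (suc top)                               ∎
  ... | odd q = subst (Between _ _) (sym total) (n≤1+n _ , ≤-refl)
    where
    open ≡-Reasoning
    total : suc (zig (suc (q + q))) + suc (zig (suc (suc (q + q)))) ≡ suc (suc (suc top))
    total = begin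
      suc (zig (suc (q + q))) + suc (zig (suc (suc (q + q))))
        ≡⟨ cong₂ (λ x y → suc x + suc y) (zig-odd q) (trans (cong (zig ∘ suc) (sym (+-suc q q))) (zig-even (suc q))) ⟩
      suc (top ∸ q) + suc (suc q)
        ≡⟨ cong suc (trans (+-suc (top ∸ q) (suc q)) (cong suc (+-suc (top ∸ q) q))) ⟩
      suc (suc (suc ((top ∸ q) + q)))
        ≡⟨ cong (suc ∘ suc ∘ suc) (m∸n+n≡m (≤-trans (m≤n+m q q) (≤-trans (n≤1+n _) (≤-trans (n≤1+n _) r<top)))) ⟩
      suc (suc (suc top)) ∎

  module _ (g : ℕ) (g+g≤top : g + g ≤ top) where

    -- next to a virtual edge a label may be at most (top + 1) ∸ g
    zig-even-small : ∀ q → q + q ≤ top → suc (zig (q + q)) ≤ suc top ∸ g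
    zig-even-small q q+q≤top =
      subst (_≤ suc top ∸ g) (cong suc (sym (zig-even q))) (m+n≤o⇒m≤o∸n (suc q) {g} (s≤s (half-sum q g q+q≤top g+g≤top)))

    zig-late-small : ∀ {r} → suc (g + g) ≤ r → r ≤ top → suc (zig r) ≤ suc top ∸ g
    zig-late-small {r} k≤r r≤top with parity r
    ... | even q = zig-even-small q r≤top
    ... | odd q  = begin
      suc (zig (suc (q + q))) ≡⟨ cong suc (zig-odd q) ⟩
      suc (top ∸ q)           ≤⟨ s≤s (∸-monoʳ-≤ top g≤q) ⟩
      suc (top ∸ g)           ≡⟨ +-∸-assoc 1 (≤-trans (m≤n+m g g) g+g≤top) ⟨
      suc top ∸ g             ∎
      where
      open ≤-Reasoning
      g≤q : g ≤ q
      g≤q = ≮⇒≥ (λ q<g → <⇒≱ (+-mono-< q<g q<g) (s≤s⁻¹ k≤r))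

∸-suc : ∀ {m n} → suc n ≤ m → m ∸ n ≡ suc (m ∸ suc n)
∸-suc {suc m} n<m = +-∸-assoc 1 (s≤s⁻¹ n<m)

-- The arrangement sending r to r or to top ∸ r, according to the parity of its
-- distance r ⊓ (top ∸ r) to the nearer end; the choice is symmetric, so it is an involution.
module Reflect (top : ℕ) where

  keeps : ℕ → Bool
  keeps r = not (odd? (r ⊓ (top ∸ r)))

  reflect : ℕ → ℕ
  reflect r = if keeps r then r else top ∸ r

  keeps-sym : ∀ {r} → r ≤ top → keeps (top ∸ r) ≡ keeps r
  keeps-sym {r} r≤top = cong (not ∘ odd?) (trans (cong ((top ∸ r) ⊓_) (m∸[m∸n]≡n r≤top)) (⊓-comm (top ∸ r) r))

  reflect≤ : ∀ {r} → r ≤ top → reflect r ≤ top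
  reflect≤ {r} r≤top with keeps r
  ... | true  = r≤top
  ... | false = m∸n≤m top r

  reflect-involutive : ∀ {r} → r ≤ top → reflect (reflect r) ≡ r
  reflect-involutive {r} r≤top with keeps r in eq
  ... | true  rewrite eq = refl
  ... | false rewrite keeps-sym r≤top | eq = m∸[m∸n]≡n r≤top

  reflection : Arrangement (suc top)
  reflection = arrangement reflect reflect reflect≤ reflect≤ reflect-involutive reflect-involutive

  private
    low : ∀ {x} → Between x (suc (suc x)) x
    low = ≤-refl , ≤-trans (n≤1+n _) (n≤1+n _)
    mid : ∀ {x} → Between x (suc (suc x)) (suc x)
    mid = n≤1+n _ , n≤1+n _
    high : ∀ {x} → Between x (suc (suc x)) (suc (suc x))
    high = ≤-trans (n≤1+n _) (n≤1+n _) , ≤-refl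
    swap-suc : ∀ a b → suc b + suc a ≡ suc (suc (a + b))
    swap-suc = solve-∀

  -- with top = suc (a + b), the values at a and suc a are a or suc b, and suc a or b
  neighbour-sum : ∀ a b → Between (a + b) (suc (suc (a + b)))
    ((if not (odd? (a ⊓ suc b)) then a else suc b) + (if not (odd? (suc a ⊓ b)) then suc a else b))
  neighbour-sum a b with <-cmp a b
  ... | tri< a<b _ _ rewrite m≤n⇒m⊓n≡m (≤-trans (n≤1+n a) (≤-trans a<b (n≤1+n b))) | m≤n⇒m⊓n≡m a<b with odd? a
  ...   | false = low
  ...   | true  = subst (Between _ _) (sym (swap-suc a b)) high
  neighbour-sum a b | tri≈ _ refl _ rewrite m≤n⇒m⊓n≡m (n≤1+n a) | m≥n⇒m⊓n≡n (n≤1+n a) with odd? a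
  ...   | false = subst (Between _ _) (sym (+-suc a a)) mid
  ...   | true  = mid
  neighbour-sum a b | tri> _ _ b<a rewrite m≥n⇒m⊓n≡n b<a | m≥n⇒m⊓n≡n (≤-trans (n≤1+n b) (≤-trans b<a (n≤1+n a))) with odd? b
  ...   | false = subst (Between _ _) (sym (swap-suc a b)) high
  ...   | true  = low

  reflect-neighbours : ∀ {r} → suc r ≤ top → Between (suc top) (suc (suc (suc top))) (suc (reflect r) + suc (reflect (suc r)))
  reflect-neighbours {r} r<top =
    subst (λ t → Between (suc t) (suc (suc (suc t))) (suc (reflect r) + suc (reflect (suc r)))) (m+[n∸m]≡n r<top)
      (between-suc² {x = reflect r} {reflect (suc r)} values)
    where
    b : ℕ
    b = top ∸ suc r
    values : Between (r + b) (suc (suc (r + b))) (reflect r + reflect (suc r))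
    values = subst (λ x → Between (r + b) (suc (suc (r + b))) ((if not (odd? (r ⊓ x)) then r else x) + reflect (suc r)))
                   (sym (∸-suc r<top)) (neighbour-sum r b)

  reflect-end : reflect top ≡ top
  reflect-end = trans (cong (λ x → if not (odd? (top ⊓ x)) then top else x) (n∸n≡0 top))
                      (cong (λ x → if not (odd? x) then top else 0) (⊓-zeroʳ top))

  reflect-wrap : Between (suc top) (suc (suc (suc top))) (suc (reflect top) + suc (reflect 0))
  reflect-wrap = subst (Between _ _) (sym (trans (cong (λ x → suc x + 1) reflect-end) (+-comm (suc top) 1))) (n≤1+n _ , n≤1+n _)

-- Joints of a labelled circuit

-- The label of the edge of a dart, or nothing for a virtual edge.
Slot : Set
Slot = Maybe ℕ

weight isReal : Slot → ℕ
weight (just x) = x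
weight nothing  = 0
isReal (just _) = 1
isReal nothing  = 0

bothReal oneReal noneReal : Slot → Slot → ℕ
bothReal (just _) (just _) = 1
bothReal _        _        = 0
oneReal  (just _) nothing  = 1
oneReal  nothing  (just _) = 1
oneReal  _        _        = 0
noneReal nothing  nothing  = 1
noneReal _        _        = 0

kinds-cover : ∀ s t → 1 + 1 ≡ 2 * (bothReal s t + oneReal s t + noneReal s t)
kinds-cover (just _) (just _) = refl
kinds-cover (just _) nothing  = refl
kinds-cover nothing  (just _) = refl
kinds-cover nothing  nothing  = refl

kinds-real : ∀ s t → isReal s + isReal t ≡ 2 * bothReal s t + oneReal s t
kinds-real (just _) (just _) = refl
kinds-real (just _) nothing  = refl
kinds-real nothing  (just _) = refl
kinds-real nothing  nothing  = refl

-- Admissible sums of the two labels at a joint: lo₂ … hi₂ if both edges are real,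
-- lo₁ … hi₁ (for the one real label) if exactly one is.
record Window : Set where
  field
    lo₂ hi₂ lo₁ hi₁ : ℕ

  RealPair : ℕ → ℕ → Set
  RealPair x y = Between lo₂ hi₂ (x + y)

  Exposed : ℕ → Set
  Exposed = Between lo₁ hi₁

  Good : Slot → Slot → Set
  Good (just x) (just y) = RealPair x y
  Good (just x) nothing  = Exposed x
  Good nothing  (just y) = Exposed y
  Good nothing  nothing  = ⊤

  private
    between-≡ : ∀ {lo lo′ hi hi′ x x′} → lo ≡ lo′ → hi ≡ hi′ → x ≡ x′ → Between lo hi x → Between lo′ hi′ x′
    between-≡ refl refl refl b = b
    only₂ : ∀ a b → a ≡ a * 1 + b * 0
    only₂ = solve-∀
    only₁ : ∀ a b → b ≡ a * 0 + b * 1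
    only₁ = solve-∀
    neither : ∀ a b → 0 ≡ a * 0 + b * 0
    neither = solve-∀

  good-bounds : ∀ s t → Good s t →
    Between (lo₂ * bothReal s t + lo₁ * oneReal s t) (hi₂ * bothReal s t + hi₁ * oneReal s t) (weight s + weight t)
  good-bounds (just x) (just y) g  = between-≡ (only₂ lo₂ lo₁) (only₂ hi₂ hi₁) refl g
  good-bounds (just x) nothing  g  = between-≡ (only₁ lo₂ lo₁) (only₁ hi₂ hi₁) (sym (+-identityʳ x)) g
  good-bounds nothing  (just y) g  = between-≡ (only₁ lo₂ lo₁) (only₁ hi₂ hi₁) refl g
  good-bounds nothing  nothing  tt = between-≡ (neither lo₂ lo₁) (neither hi₂ hi₁) refl (z≤n , z≤n)

  mutual
    after-real : ∀ x q → Exposed x → All Exposed (catMaybes q) → Linked RealPair (x ∷ catMaybes q) →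
      Linked Good (just x ∷ q ++ [ nothing ])
    after-real x []            ex _          _          = ex ∷ [-]
    after-real x (just y ∷ q)  ex (ey ∷ exs) (xy ∷ rps) = xy ∷ after-real y q ey exs rps
    after-real x (nothing ∷ q) ex exs        rps        = ex ∷ after-virtual q exs (Linked.tail rps)

    after-virtual : ∀ q → All Exposed (catMaybes q) → Linked RealPair (catMaybes q) →
      Linked Good (nothing ∷ q ++ [ nothing ])
    after-virtual []            _          _   = tt ∷ [-]
    after-virtual (just y ∷ q)  (ey ∷ exs) rps = ey ∷ after-real y q ey exs rps
    after-virtual (nothing ∷ q) exs        rps = tt ∷ after-virtual q exs rps

  block : ∀ f j q → Exposed (f j) → All Exposed (catMaybes q) → Linked RealPair (applyUpTo f (suc j) ++ catMaybes q) →
    Linked Good (map just (applyUpTo f (suc j)) ++ q ++ [ nothing ])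
  block f zero    q ex exs rps        = after-real (f 0) q ex exs rps
  block f (suc j) q ex exs (xy ∷ rps) = xy ∷ block (f ∘ suc) j q ex exs rps

-- c₂, c₁, c₀ count the joints at a vertex with two, one and no real edges;
-- the degree in G is 2 * g + t and the number t ≤ 1 of virtual edges makes it even.
counts-from-degrees : ∀ {c₂ c₁ c₀ g t} → t ≤ 1 →
  2 * (c₂ + c₁ + c₀) ≡ 2 * g + t + t → 2 * c₂ + c₁ ≡ 2 * g + t → c₂ ≡ g × c₁ ≡ t
counts-from-degrees {c₂} {c₁} {c₀} {g} {t} t≤1 all real = c₂≡g , c₁≡t
  where
  open ≡-Reasoning
  split : ∀ a b c → 2 * a + b + (b + 2 * c) ≡ 2 * (a + b + c)
  split = solve-∀
  rest : c₁ + 2 * c₀ ≡ t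
  rest = +-cancelˡ-≡ (2 * g + t) _ _ (begin
    2 * g + t + (c₁ + 2 * c₀)   ≡⟨ cong (_+ (c₁ + 2 * c₀)) real ⟨
    2 * c₂ + c₁ + (c₁ + 2 * c₀) ≡⟨ split c₂ c₁ c₀ ⟩
    2 * (c₂ + c₁ + c₀)          ≡⟨ all ⟩
    2 * g + t + t               ∎)
  no-double : ∀ x → 2 * x ≤ 1 → x ≡ 0
  no-double zero    _ = refl
  no-double (suc x) le with ≤-trans (≤-reflexive (solve-suc x)) le
    where
    solve-suc : ∀ x → 2 + 2 * x ≡ 2 * suc x
    solve-suc = solve-∀
  ... | s≤s ()
  c₁≡t : c₁ ≡ t
  c₁≡t = begin
    c₁           ≡⟨ +-identityʳ c₁ ⟨
    c₁ + 2 * 0   ≡⟨ cong (λ x → c₁ + 2 * x) (no-double c₀ (≤-trans (m≤n+m (2 * c₀) c₁) (≤-trans (≤-reflexive rest) t≤1))) ⟨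
    c₁ + 2 * c₀  ≡⟨ rest ⟩
    t            ∎
  c₂≡g : c₂ ≡ g
  c₂≡g = *-cancelˡ-≡ c₂ g 2 (+-cancelʳ-≡ t _ _ (subst (λ x → 2 * c₂ + x ≡ 2 * g + t) c₁≡t real))

module _ {n m} (G : Graph n m) where

  endpoints : Fin m → Fin n → ℕ
  endpoints e v = δ (proj₁ (ends G e)) v + δ (proj₂ (ends G e)) v

  -- incident G counts an edge once; for a loopless edge so does endpoints
  incident-endpoints : ∀ e v x → (if incident G e v then x else 0) ≡ endpoints e v * x
  incident-endpoints e v x with proj₁ (ends G e) ≟ v | proj₂ (ends G e) ≟ v
  ... | yes p | yes q = ⊥-elim (loopless G e (trans p (sym q)))
  ... | yes _ | no _  = sym (+-identityʳ x)
  ... | no _  | yes _ = sym (+-identityʳ x)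
  ... | no _  | no _  = refl

  degree-endpoints : ∀ v → degree G v ≡ ∑[ e ∈ allFin m ] endpoints e v
  degree-endpoints v = ∑-cong (allFin m) (λ e → trans (incident-endpoints e v 1) (*-identityʳ _))

  handshake : (∑[ v ∈ allFin n ] degree G v) ≡ m + m
  handshake = begin
    (∑[ v ∈ allFin n ] degree G v)                    ≡⟨ ∑-cong (allFin n) degree-endpoints ⟩
    (∑[ v ∈ allFin n ] ∑[ e ∈ allFin m ] endpoints e v) ≡⟨ ∑-comm (allFin n) (allFin m) (λ v e → endpoints e v) ⟩
    (∑[ e ∈ allFin m ] ∑[ v ∈ allFin n ] endpoints e v) ≡⟨ ∑-cong (allFin m) two-ends ⟩
    (∑[ e ∈ allFin m ] (1 + 1))                       ≡⟨ ∑-+ (allFin m) (λ _ → 1) (λ _ → 1) ⟩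
    (∑[ e ∈ allFin m ] 1) + (∑[ e ∈ allFin m ] 1)     ≡⟨ cong (λ x → x + x) (trans (∑-allFin-const m 1) (*-identityʳ m)) ⟩
    m + m                                             ∎
    where
    open ≡-Reasoning
    two-ends : ∀ e → (∑[ v ∈ allFin n ] endpoints e v) ≡ 1 + 1
    two-ends e = trans (∑-+ (allFin n) _ _) (cong₂ _+_ (∑-δ (proj₁ (ends G e))) (∑-δ (proj₂ (ends G e))))


-- G together with h virtual edges; labels are only given to the edges of G.
module Augmented {n m h : ℕ} (G : Graph n m) (virtual : Fin h → Fin n × Fin n) where

  endsᴴ : Fin m ⊎ Fin h → Fin n × Fin n
  endsᴴ (inj₁ i) = ends G i
  endsᴴ (inj₂ j) = virtual j

  edgesᴴ : List (Fin m ⊎ Fin h)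
  edgesᴴ = map inj₁ (allFin m) ++ map inj₂ (allFin h)

  ∈-edgesᴴ : ∀ e → e ∈ edgesᴴ
  ∈-edgesᴴ (inj₁ i) = ∈-++⁺ˡ (∈-map⁺ inj₁ (∈-allFin i))
  ∈-edgesᴴ (inj₂ j) = ∈-++⁺ʳ (map inj₁ (allFin m)) (∈-map⁺ inj₂ (∈-allFin j))

  open Multigraph endsᴴ public
  open Euler edgesᴴ ∈-edgesᴴ public

  ∑-edgesᴴ : ∀ f → (∑[ e ∈ edgesᴴ ] f e) ≡ (∑[ i ∈ allFin m ] f (inj₁ i)) + (∑[ j ∈ allFin h ] f (inj₂ j))
  ∑-edgesᴴ f = trans (∑-++ (map inj₁ (allFin m)) _ f) (cong₂ _+_ (∑-map inj₁ (allFin m) f) (∑-map inj₂ (allFin h) f))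

  virtualDegree : Fin n → ℕ
  virtualDegree v = ∑[ j ∈ allFin h ] incidence (inj₂ j) v

  ∑-edgesᴴ-real : ∀ F → (∀ j → F (inj₂ j) ≡ 0) → (∑[ e ∈ edgesᴴ ] F e) ≡ ∑[ i ∈ allFin m ] F (inj₁ i)
  ∑-edgesᴴ-real F virtual-0 = trans (∑-edgesᴴ F)
    (trans (cong (_ +_) (trans (∑-cong (allFin h) virtual-0) (∑-zero (allFin h)))) (+-identityʳ _))

  multidegree-augmented : ∀ v → multidegree v ≡ degree G v + virtualDegree v
  multidegree-augmented v = trans (∑-edgesᴴ (λ e → incidence e v)) (cong (_+ virtualDegree v) (sym (degree-endpoints G v)))

  walk-of-reach : ∀ {u v} → Reach G u v → ∃[ ds ] Walk u ds v
  walk-of-reach here = [] , []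
  walk-of-reach (step (e , inj₁ uv) r) with walk-of-reach r
  ... | ds , w = (inj₁ e , false) ∷ ds , step _ (cong proj₁ uv) (subst (λ x → Walk x ds _) (sym (cong proj₂ uv)) w)
  walk-of-reach (step (e , inj₂ vu) r) with walk-of-reach r
  ... | ds , w = (inj₁ e , true) ∷ ds , step _ (cong proj₂ vu) (subst (λ x → Walk x ds _) (sym (cong proj₁ vu)) w)

  Real : Dart → Set
  Real (inj₁ _ , _) = ⊤
  Real (inj₂ _ , _) = ⊥

  realEdges : List Dart → List (Fin m)
  realEdges ds = mapMaybe isInj₁ (map edge ds)

  virtualEdges : List Dart → List (Fin h)
  virtualEdges ds = mapMaybe isInj₂ (map edge ds)

  realEdges-covers : ∀ {ds} → map edge ds ↭ edgesᴴ → realEdges ds ↭ allFin m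
  realEdges-covers covers = ↭-trans (mapMaybe-↭ isInj₁ covers) (↭-reflexive (real-part (allFin m)))
    where
    no-real : ∀ js → mapMaybe isInj₁ (map (inj₂ {A = Fin m}) js) ≡ []
    no-real []       = refl
    no-real (j ∷ js) = no-real js
    real-part : ∀ is → mapMaybe isInj₁ (map inj₁ is ++ map inj₂ (allFin h)) ≡ is
    real-part []       = no-real (allFin h)
    real-part (i ∷ is) = cong (i ∷_) (real-part is)

  virtualEdges-covers : ∀ {ds} → map edge ds ↭ edgesᴴ → virtualEdges ds ↭ allFin h
  virtualEdges-covers covers = ↭-trans (mapMaybe-↭ isInj₂ covers) (↭-reflexive (virtual-part (allFin m)))
    where
    only-virtual : ∀ js → mapMaybe isInj₂ (map (inj₂ {A = Fin m}) js) ≡ js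
    only-virtual []       = refl
    only-virtual (j ∷ js) = cong (j ∷_) (only-virtual js)
    virtual-part : ∀ is → mapMaybe isInj₂ (map inj₁ is ++ map inj₂ (allFin h)) ≡ allFin h
    virtual-part []       = only-virtual (allFin h)
    virtual-part (i ∷ is) = virtual-part is

  rotate-circuit : ∀ {a} xs {ys} → Walk a (xs ++ ys) a → map edge (xs ++ ys) ↭ edgesᴴ →
    ∃[ b ] (Walk b (ys ++ xs) b × map edge (ys ++ xs) ↭ edgesᴴ)
  rotate-circuit xs {ys} w covers with rotate xs w
  ... | b , w′ = b , w′ , ↭-trans (↭-map⁺ edge (++-comm ys xs)) covers

  Run : ℕ → List Dart → Set
  Run k ds = ∃[ xs ] ∃[ j ] ∃[ o ] ∃[ B ] ∃[ R ] (ds ≡ xs ++ (inj₂ j , o) ∷ B ++ R × All Real B × length B ≡ k)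

  Run-prefix : ∀ {k} ys {ds} → Run k ds → Run k (ys ++ ds)
  Run-prefix ys (xs , j , o , B , R , refl , real , len) = ys ++ xs , j , o , B , R , sym (++-assoc ys xs _) , real , len

  scan : ∀ k′ j o B L → All Real B → length B ≤ k′ →
    Run (suc k′) ((inj₂ j , o) ∷ B ++ L) ⊎ length B + length (realEdges L) ≤ k′ * suc (length (virtualEdges L))
  scan k′ j o B [] real len = inj₂ (subst₂ _≤_ (sym (+-identityʳ _)) (sym (*-identityʳ k′)) len)
  scan k′ j o B (d@(inj₁ i , _) ∷ L) real len with length B ≟ℕ k′
  ... | yes refl = inj₁ ([] , j , o , B ++ [ d ] , L , cong ((inj₂ j , o) ∷_) (sym (++-assoc B [ d ] L)) ,
                         All.++⁺ real (tt ∷ []) , length-∷ʳ B)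
  ... | no  len≢ with scan k′ j o (B ++ [ d ]) L (All.++⁺ real (tt ∷ [])) (subst (_≤ k′) (sym (length-∷ʳ B)) (≤∧≢⇒< len len≢))
  ...   | inj₁ run   = inj₁ (subst (Run (suc k′)) (cong ((inj₂ j , o) ∷_) (++-assoc B [ d ] L)) run)
  ...   | inj₂ bound = inj₂ (subst (_≤ k′ * suc (length (virtualEdges L))) (trans (cong (_+ length (realEdges L)) (length-∷ʳ B)) (sym (+-suc _ _))) bound)
  scan k′ j o B ((inj₂ j′ , o′) ∷ L) real len with scan k′ j′ o′ [] L [] z≤n
  ... | inj₁ run   = inj₁ (Run-prefix ((inj₂ j , o) ∷ B) run)
  ... | inj₂ bound = inj₂ (subst (length B + length (realEdges L) ≤_) (sym (*-suc k′ _)) (+-mono-≤ len bound))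

  virtual-first : ∀ {a ds} → Fin h → Walk a ds a → map edge ds ↭ edgesᴴ →
    ∃[ b ] ∃[ j ] ∃[ o ] ∃[ L ] (Walk b ((inj₂ j , o) ∷ L) b × map edge ((inj₂ j , o) ∷ L) ↭ edgesᴴ)
  virtual-first j₀ w covers with ∈-map⁻ edge (∈-resp-↭ (↭-sym covers) (∈-edgesᴴ (inj₂ j₀)))
  ... | (_ , o) , d∈ , refl with ∈-∃++ d∈
  ...   | xs , ys , refl with rotate-circuit xs w covers
  ...     | b , w′ , covers′ = b , j₀ , o , ys ++ xs , w′ , covers′

  -- The m = h · (k′ + 1) real darts of an Euler circuit fill the h gaps between its
  -- virtual darts, so some gap holds at least k′ + 1 of them.
  long-run : ∀ {a ds} k′ → Fin h → m ≡ h * suc k′ → Walk a ds a → map edge ds ↭ edgesᴴ →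
    ∃[ b ] ∃[ j ] ∃[ o ] ∃[ B ] ∃[ R ] (Walk b ((inj₂ j , o) ∷ B ++ R) b ×
      map edge ((inj₂ j , o) ∷ B ++ R) ↭ edgesᴴ × All Real B × length B ≡ suc k′)
  long-run k′ j₀ m≡ w covers with virtual-first j₀ w covers
  ... | a₁ , j₁ , o₁ , L , w₁ , covers₁ with scan k′ j₁ o₁ [] L [] z≤n
  ...   | inj₂ bound = ⊥-elim (<⇒≱ (≤-trans (s≤s z≤n) (toℕ<n j₀)) (+-cancelʳ-≤ (h * k′) h 0 (begin
    h + h * k′                                 ≡⟨ *-suc h k′ ⟨
    h * suc k′                                 ≡⟨ m≡ ⟨
    m                                          ≡⟨ trans (↭-length (realEdges-covers {(inj₂ j₁ , o₁) ∷ L} covers₁)) (length-allFin m) ⟨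
    length (realEdges L)                       ≤⟨ bound ⟩
    k′ * suc (length (virtualEdges L))         ≡⟨ cong (k′ *_) (trans (↭-length (virtualEdges-covers {(inj₂ j₁ , o₁) ∷ L} covers₁)) (length-allFin h)) ⟩
    k′ * h                                     ≡⟨ *-comm k′ h ⟩
    h * k′                                     ∎)))
    where open ≤-Reasoning
  ...   | inj₁ (zs , j , o , B , R , eq , real , len)
    with rotate-circuit zs (subst (λ l → Walk a₁ l a₁) eq w₁) (subst (λ l → map edge l ↭ edgesᴴ) eq covers₁)
  ...     | b , w₂ , covers₂ = b , j , o , B , R ++ zs ,
                subst (λ l → Walk b ((inj₂ j , o) ∷ l) b) (++-assoc B R zs) w₂ ,
                subst (λ l → map edge ((inj₂ j , o) ∷ l) ↭ edgesᴴ) (++-assoc B R zs) covers₂ , real , len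

  module Labelled {a ds} (circuit : Walk a ds a) (covers : map edge ds ↭ edgesᴴ) (A : Arrangement m) where

    f : Labeling m
    f = labelling (realEdges-covers covers) A

    slotᴴ : Fin m ⊎ Fin h → Slot
    slotᴴ (inj₁ i) = just (label f i)
    slotᴴ (inj₂ _) = nothing

    slot : Dart → Slot
    slot = slotᴴ ∘ edge

    real-labels : catMaybes (map slot ds) ≡ applyUpTo (suc ∘ Arrangement.value A) m
    real-labels = trans (cong catMaybes (map-∘ ds)) (trans (along (map edge ds)) (labels-along (realEdges-covers covers) A))
      where
      along : ∀ es → catMaybes (map slotᴴ es) ≡ map (label f) (mapMaybe isInj₁ es)
      along []            = refl
      along (inj₁ i ∷ es) = cong (label f i ∷_) (along es)
      along (inj₂ j ∷ es) = along es

    real-slots : ∀ xs → All Real xs → map slot xs ≡ map just (catMaybes (map slot xs))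
    real-slots []                  []         = refl
    real-slots ((inj₁ i , _) ∷ xs) (_ ∷ real) = cong (just (label f i) ∷_) (real-slots xs real)

    ∑-circuit : ∀ F → (∑[ x ∈ ds ] F (edge x)) ≡ ∑ edgesᴴ F
    ∑-circuit F = trans (sym (∑-map edge ds F)) (∑-↭ F covers)

    joints : (Slot → Slot → ℕ) → Fin n → ℕ
    joints K v = jointSum v (λ x y → K (slot x) (slot y)) (cyclic ds)

    vertexSum-joints : ∀ v → vertexSum G f v ≡ jointSum v (λ x y → weight (slot x) + weight (slot y)) (cyclic ds)
    vertexSum-joints v = begin
      vertexSum G f v
        ≡⟨ ∑-cong (allFin m) (λ i → incident-endpoints G i v (label f i)) ⟩
      (∑[ i ∈ allFin m ] incidence (inj₁ i) v * label f i)
        ≡⟨ ∑-edgesᴴ-real (λ e → incidence e v * weight (slotᴴ e)) (λ j → *-zeroʳ (incidence (inj₂ j) v)) ⟨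
      (∑[ e ∈ edgesᴴ ] incidence e v * weight (slotᴴ e))
        ≡⟨ ∑-circuit (λ e → incidence e v * weight (slotᴴ e)) ⟨
      (∑[ x ∈ ds ] incidence (edge x) v * weight (slot x))
        ≡⟨ jointSum-closed (weight ∘ slot) v circuit ⟨
      jointSum v (λ x y → weight (slot x) + weight (slot y)) (cyclic ds) ∎
      where open ≡-Reasoning

    joints-cong : ∀ {K L} v → (∀ s t → K s t ≡ L s t) → joints K v ≡ joints L v
    joints-cong v K≗L = jointSum-cong v (cyclic ds) (λ x y → K≗L (slot x) (slot y))

    joints-+ : ∀ K L v → joints (λ s t → K s t + L s t) v ≡ joints K v + joints L v
    joints-+ K L v = jointSum-+ v (λ x y → K (slot x) (slot y)) (λ x y → L (slot x) (slot y)) (cyclic ds)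

    joints-* : ∀ c K v → joints (λ s t → c * K s t) v ≡ c * joints K v
    joints-* c K v = jointSum-* v c (λ x y → K (slot x) (slot y)) (cyclic ds)

    count-all : ∀ v → 2 * (joints bothReal v + joints oneReal v + joints noneReal v) ≡ multidegree v
    count-all v = begin
      2 * (joints bothReal v + joints oneReal v + joints noneReal v)
        ≡⟨ cong (λ x → 2 * (x + joints noneReal v)) (joints-+ bothReal oneReal v) ⟨
      2 * (joints (λ s t → bothReal s t + oneReal s t) v + joints noneReal v)
        ≡⟨ cong (2 *_) (joints-+ (λ s t → bothReal s t + oneReal s t) noneReal v) ⟨
      2 * joints (λ s t → bothReal s t + oneReal s t + noneReal s t) v
        ≡⟨ joints-* 2 (λ s t → bothReal s t + oneReal s t + noneReal s t) v ⟨
      joints (λ s t → 2 * (bothReal s t + oneReal s t + noneReal s t)) v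
        ≡⟨ joints-cong v (λ s t → kinds-cover s t) ⟨
      jointSum v (λ _ _ → 1 + 1) (cyclic ds)
        ≡⟨ jointSum-closed (λ _ → 1) v circuit ⟩
      (∑[ x ∈ ds ] incidence (edge x) v * 1)
        ≡⟨ ∑-circuit (λ e → incidence e v * 1) ⟩
      (∑[ e ∈ edgesᴴ ] incidence e v * 1)
        ≡⟨ ∑-cong edgesᴴ (λ e → *-identityʳ (incidence e v)) ⟩
      multidegree v ∎
      where open ≡-Reasoning

    count-real : ∀ v → 2 * joints bothReal v + joints oneReal v ≡ degree G v
    count-real v = begin
      2 * joints bothReal v + joints oneReal v
        ≡⟨ cong (_+ joints oneReal v) (joints-* 2 bothReal v) ⟨
      joints (λ s t → 2 * bothReal s t) v + joints oneReal v
        ≡⟨ joints-+ (λ s t → 2 * bothReal s t) oneReal v ⟨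
      joints (λ s t → 2 * bothReal s t + oneReal s t) v
        ≡⟨ joints-cong v (λ s t → kinds-real s t) ⟨
      jointSum v (λ x y → isReal (slot x) + isReal (slot y)) (cyclic ds)
        ≡⟨ jointSum-closed (isReal ∘ slot) v circuit ⟩
      (∑[ x ∈ ds ] incidence (edge x) v * isReal (slot x))
        ≡⟨ ∑-circuit (λ e → incidence e v * isReal (slotᴴ e)) ⟩
      (∑[ e ∈ edgesᴴ ] incidence e v * isReal (slotᴴ e))
        ≡⟨ ∑-edgesᴴ-real (λ e → incidence e v * isReal (slotᴴ e)) (λ j → *-zeroʳ (incidence (inj₂ j) v)) ⟩
      (∑[ i ∈ allFin m ] incidence (inj₁ i) v * 1)
        ≡⟨ ∑-cong (allFin m) (λ i → *-identityʳ (incidence (inj₁ i) v)) ⟩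
      (∑[ i ∈ allFin m ] incidence (inj₁ i) v)
        ≡⟨ degree-endpoints G v ⟨
      degree G v ∎
      where open ≡-Reasoning

    joint-counts : ∀ {g t} → t ≤ 1 → Regular G (2 * g + t) → (∀ v → virtualDegree v ≡ t) →
      ∀ v → joints bothReal v ≡ g × joints oneReal v ≡ t
    joint-counts t≤1 regular virtual-t v = counts-from-degrees t≤1
      (trans (count-all v) (trans (multidegree-augmented v) (cong₂ _+_ (regular v) (virtual-t v))))
      (trans (count-real v) (regular v))

    module _ (W : Window) (good : Linked (Window.Good W) (map slot (cyclic ds))) where
      open Window W

      bounds : ∀ v → Between (lo₂ * joints bothReal v + lo₁ * joints oneReal v)
                             (hi₂ * joints bothReal v + hi₁ * joints oneReal v) (vertexSum G f v)
      bounds v = subst₂ _≤_ (linear lo₂ lo₁) (sym (vertexSum-joints v)) (jointSum-mono v (Linked.map proj₁ pointwise))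
               , subst₂ _≤_ (sym (vertexSum-joints v)) (linear hi₂ hi₁) (jointSum-mono v (Linked.map proj₂ pointwise))
        where
        pointwise : Linked (λ x y → Between (lo₂ * bothReal (slot x) (slot y) + lo₁ * oneReal (slot x) (slot y))
                                            (hi₂ * bothReal (slot x) (slot y) + hi₁ * oneReal (slot x) (slot y))
                                            (weight (slot x) + weight (slot y))) (cyclic ds)
        pointwise = Linked.map (λ {x} {y} → good-bounds (slot x) (slot y)) (map⁻ good)
        linear : ∀ p q → joints (λ s t → p * bothReal s t + q * oneReal s t) v ≡ p * joints bothReal v + q * joints oneReal v
        linear p q = trans (joints-+ (λ s t → p * bothReal s t) (λ s t → q * oneReal s t) v) (cong₂ _+_ (joints-* p bothReal v) (joints-* q oneReal v))

      spread : ∀ {g t D} → (∀ v → joints bothReal v ≡ g × joints oneReal v ≡ t) →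
        hi₂ * g + hi₁ * t ≤ lo₂ * g + lo₁ * t + D → ApproxMagicLabeling G D f
      spread {g} {t} {D} counts slack u v = begin
        vertexSum G f u                   ≤⟨ proj₂ (bounds u) ⟩
        hi₂ * joints bothReal u + hi₁ * joints oneReal u ≡⟨ cong₂ (λ x y → hi₂ * x + hi₁ * y) (proj₁ (counts u)) (proj₂ (counts u)) ⟩
        hi₂ * g + hi₁ * t                 ≤⟨ slack ⟩
        lo₂ * g + lo₁ * t + D             ≡⟨ cong₂ (λ x y → lo₂ * x + lo₁ * y + D) (proj₁ (counts v)) (proj₂ (counts v)) ⟨
        lo₂ * joints bothReal v + lo₁ * joints oneReal v + D ≤⟨ +-monoˡ-≤ D (proj₁ (bounds v)) ⟩
        vertexSum G f v + D               ∎
        where open ≤-Reasoning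

-- Regular graphs of even and odd degree

module EvenDegree {n top} (G : Graph n (suc top)) (g : ℕ) (regular : Regular G (2 * g)) where

  open Augmented {h = 0} G (λ ())
  open Reflect top

  regular′ : Regular G (2 * g + 0)
  regular′ v = trans (regular v) (sym (+-identityʳ (2 * g)))

  even-degree : ∀ v → 2 ∣ multidegree v
  even-degree v = divides g (trans (multidegree-augmented v) (trans (+-identityʳ _) (trans (regular v) (*-comm 2 g))))

  -- without virtual edges there are no joints with one real edge, so lo₁ and hi₁ are irrelevant
  window : Window
  window = record { lo₂ = suc top ; hi₂ = suc (suc (suc top)) ; lo₁ = 0 ; hi₁ = 0 }
  open Window window using (Good; RealPair)

  all-real : ∀ xs → All Real xs
  all-real []                  = []
  all-real ((inj₁ _ , _) ∷ xs) = tt ∷ all-real xs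

  labels : List ℕ
  labels = applyUpTo (suc ∘ reflect) (suc top)

  labels-linked : Linked RealPair (cyclic labels)
  labels-linked = linked-applyUpTo-∷ʳ (suc ∘ reflect) top (suc (reflect 0))
    (applyUpTo⁺₁ (suc ∘ reflect) (suc top) (λ lt → reflect-neighbours (s≤s⁻¹ lt))) reflect-wrap

  slack : suc (suc (suc top)) * g + 0 * 0 ≤ suc top * g + 0 * 0 + 2 * g
  slack = ≤-reflexive (regroup top g)
    where
    regroup : ∀ t g → (3 + t) * g + 0 * 0 ≡ (1 + t) * g + 0 * 0 + 2 * g
    regroup = solve-∀

  module _ {a ds} (circuit : Walk a ds a) (covers : map edge ds ↭ edgesᴴ) where

    open Labelled circuit covers reflection

    good : Linked Good (map slot (cyclic ds))
    good = subst (Linked Good) (sym profile) (map⁺ labels-linked)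
      where
      profile : map slot (cyclic ds) ≡ map just (cyclic labels)
      profile = begin
        map slot (cyclic ds)                        ≡⟨ map-cyclic slot ds ⟩
        cyclic (map slot ds)                        ≡⟨ cong cyclic (real-slots ds (all-real ds)) ⟩
        cyclic (map just (catMaybes (map slot ds))) ≡⟨ cong (cyclic ∘ map just) real-labels ⟩
        cyclic (map just labels)                    ≡⟨ map-cyclic just labels ⟨
        map just (cyclic labels)                    ∎
        where open ≡-Reasoning

    circuit-approxMagic : ApproxMagic G (2 * g)
    circuit-approxMagic = f , spread window good {g = g} (joint-counts z≤n regular′ (λ _ → refl)) slack

  approxMagic : Connected G → Fin n → ApproxMagic G (2 * g)
  approxMagic connected a₀ with euler (λ u v → walk-of-reach (connected u v)) even-degree a₀
  ... | _ , _ , w , covers = circuit-approxMagic w covers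

∑-δ-hit : ∀ {h n} (f : Fin h → Fin n) → (∀ {i j} → f i ≡ f j → i ≡ j) → ∀ i → (∑[ j ∈ allFin h ] δ (f j) (f i)) ≡ 1
∑-δ-hit {h} f inj i = trans (∑-cong (allFin h) (λ j → trans (δ-injective inj j i) (δ-sym j i))) (∑-δ i)

∑-δ-miss : ∀ {h n} (f : Fin h → Fin n) {v} → (∀ j → f j ≢ v) → (∑[ j ∈ allFin h ] δ (f j) v) ≡ 0
∑-δ-miss {h} f miss = trans (∑-cong (allFin h) (λ j → δ-≢ (miss j))) (∑-zero (allFin h))

↑ˡ≢↑ʳ : ∀ h (i j : Fin h) → i ↑ˡ h ≢ h ↑ʳ j
↑ˡ≢↑ʳ h i j eq with trans (sym (splitAt-↑ˡ h i h)) (trans (cong (Fin.splitAt h) eq) (splitAt-↑ʳ h h j))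
... | ()

-- the virtual edges j ↦ (j ↑ˡ h , h ↑ʳ j) form a perfect matching of Fin (h + h)
matching-degree : ∀ h (v : Fin (h + h)) → (∑[ j ∈ allFin h ] (δ (j ↑ˡ h) v + δ (h ↑ʳ j) v)) ≡ 1
matching-degree h v with Fin.splitAt h v | join-splitAt h h v
... | inj₁ i | refl = trans (∑-+ (allFin h) _ _)
  (cong₂ _+_ (∑-δ-hit (_↑ˡ h) (λ {i} {j} → ↑ˡ-injective h i j) i) (∑-δ-miss (h ↑ʳ_) (λ j eq → ↑ˡ≢↑ʳ h i j (sym eq))))
... | inj₂ i | refl = trans (∑-+ (allFin h) _ _)
  (cong₂ _+_ (∑-δ-miss (_↑ˡ h) (λ j eq → ↑ˡ≢↑ʳ h j i eq)) (∑-δ-hit (h ↑ʳ_) (λ {i} {j} → ↑ʳ-injective h i j) i))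

module OddDegree {h′ top} (G : Graph (suc h′ + suc h′) (suc top)) (g : ℕ)
  (regular : Regular G (suc (g + g))) (m≡ : suc h′ * suc (g + g) ≡ suc top) where

  h k : ℕ
  h = suc h′
  k = suc (g + g)

  open Augmented G (λ j → j ↑ˡ h , h ↑ʳ j)
  open Zigzag top

  virtual-one : ∀ v → virtualDegree v ≡ 1
  virtual-one = matching-degree h

  regular′ : Regular G (2 * g + 1)
  regular′ v = trans (regular v) (double-suc g)
    where
    double-suc : ∀ g → suc (g + g) ≡ 2 * g + 1
    double-suc = solve-∀

  even-degree : ∀ v → 2 ∣ multidegree v
  even-degree v = divides (suc g) (trans (multidegree-augmented v) (trans (cong₂ _+_ (regular′ v) (virtual-one v)) (two-more g)))
    where
    two-more : ∀ g → 2 * g + 1 + 1 ≡ suc g * 2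
    two-more = solve-∀

  k≤m : k ≤ suc top
  k≤m = subst (k ≤_) m≡ (m≤m+n k (h′ * k))

  g+g≤top : g + g ≤ top
  g+g≤top = s≤s⁻¹ k≤m

  window : Window
  window = record { lo₂ = suc (suc top) ; hi₂ = suc (suc (suc top)) ; lo₁ = 1 ; hi₁ = suc top ∸ g }
  open Window window using (Good; RealPair; Exposed; block)

  labels : List ℕ
  labels = applyUpTo (suc ∘ zig) (suc top)

  labels-split : labels ≡ applyUpTo (suc ∘ zig) k ++ applyUpTo (suc ∘ zig ∘ (k +_)) (suc top ∸ k)
  labels-split = trans (cong (applyUpTo (suc ∘ zig)) (sym (m+[n∸m]≡n k≤m))) (applyUpTo-++ (suc ∘ zig) k (suc top ∸ k))

  labels-linked : Linked RealPair labels
  labels-linked = applyUpTo⁺₁ (suc ∘ zig) (suc top) (λ lt → zig-neighbours (s≤s⁻¹ lt))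

  exposed-late : All Exposed (applyUpTo (suc ∘ zig ∘ (k +_)) (suc top ∸ k))
  exposed-late = All.applyUpTo⁺₁ (suc ∘ zig ∘ (k +_)) (suc top ∸ k) (λ {i} i< →
    s≤s z≤n , zig-late-small g g+g≤top (m≤m+n k i) (s≤s⁻¹ (subst (k + i <_) (m+[n∸m]≡n k≤m) (+-monoʳ-< k i<))))

  slack : suc (suc (suc top)) * g + (suc top ∸ g) * 1 ≤ suc (suc top) * g + 1 * 1 + top
  slack = ≤-reflexive (begin
    (3 + top) * g + (suc top ∸ g) * 1 ≡⟨ regroup top g (suc top ∸ g) ⟩
    (2 + top) * g + (g + (suc top ∸ g)) ≡⟨ cong ((2 + top) * g +_) (m+[n∸m]≡n (≤-trans (m≤m+n g g) (≤-trans g+g≤top (n≤1+n top)))) ⟩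
    (2 + top) * g + suc top           ≡⟨ regroup′ top g ⟩
    (2 + top) * g + 1 * 1 + top       ∎)
    where
    open ≡-Reasoning
    regroup : ∀ t g s → (3 + t) * g + s * 1 ≡ (2 + t) * g + (g + s)
    regroup = solve-∀
    regroup′ : ∀ t g → (2 + t) * g + suc t ≡ (2 + t) * g + 1 * 1 + t
    regroup′ = solve-∀

  module _ {a j o B R} (circuit : Walk a ((inj₂ j , o) ∷ B ++ R) a)
    (covers : map edge ((inj₂ j , o) ∷ B ++ R) ↭ edgesᴴ) (real : All Real B) (len : length B ≡ k) where

    open Labelled circuit covers zigzag

    block-labels : catMaybes (map slot B) ≡ applyUpTo (suc ∘ zig) k × catMaybes (map slot R) ≡ applyUpTo (suc ∘ zig ∘ (k +_)) (suc top ∸ k)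
    block-labels = ++-injective-length (catMaybes (map slot B)) (applyUpTo (suc ∘ zig) k) lengths (begin
      catMaybes (map slot B) ++ catMaybes (map slot R) ≡⟨ catMaybes-++ (map slot B) (map slot R) ⟨
      catMaybes (map slot B ++ map slot R)             ≡⟨ cong catMaybes (map-++ slot B R) ⟨
      catMaybes (map slot (B ++ R))                    ≡⟨ real-labels ⟩
      labels                                           ≡⟨ labels-split ⟩
      applyUpTo (suc ∘ zig) k ++ applyUpTo (suc ∘ zig ∘ (k +_)) (suc top ∸ k) ∎)
      where
      open ≡-Reasoning
      lengths : length (catMaybes (map slot B)) ≡ length (applyUpTo (suc ∘ zig) k)
      lengths = begin
        length (catMaybes (map slot B))            ≡⟨ length-map just (catMaybes (map slot B)) ⟨
        length (map just (catMaybes (map slot B))) ≡⟨ cong length (real-slots B real) ⟨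
        length (map slot B)                        ≡⟨ length-map slot B ⟩
        length B                                   ≡⟨ len ⟩
        k                                          ≡⟨ length-applyUpTo (suc ∘ zig) k ⟨
        length (applyUpTo (suc ∘ zig) k)           ∎

    profile : map slot (cyclic ((inj₂ j , o) ∷ B ++ R)) ≡ nothing ∷ map just (applyUpTo (suc ∘ zig) k) ++ map slot R ++ [ nothing ]
    profile = cong (nothing ∷_) (begin
      map slot ((B ++ R) ++ [ inj₂ j , o ])           ≡⟨ cong (map slot) (++-assoc B R _) ⟩
      map slot (B ++ R ++ [ inj₂ j , o ])             ≡⟨ map-++ slot B _ ⟩
      map slot B ++ map slot (R ++ [ inj₂ j , o ])    ≡⟨ cong₂ _++_ (trans (real-slots B real) (cong (map just) (proj₁ block-labels))) (map-++ slot R _) ⟩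
      map just (applyUpTo (suc ∘ zig) k) ++ map slot R ++ [ nothing ] ∎)
      where open ≡-Reasoning

    good : Linked Good (map slot (cyclic ((inj₂ j , o) ∷ B ++ R)))
    good = subst (Linked Good) (sym profile)
      ((s≤s z≤n , zig-even-small g g+g≤top 0 z≤n) ∷
       block (suc ∘ zig) (g + g) (map slot R) (s≤s z≤n , zig-even-small g g+g≤top g g+g≤top)
         (subst (All Exposed) (sym (proj₂ block-labels)) exposed-late)
         (subst (Linked RealPair) (trans labels-split (cong (applyUpTo (suc ∘ zig) k ++_) (sym (proj₂ block-labels)))) labels-linked))

    circuit-approxMagic : ApproxMagic G top
    circuit-approxMagic = f , spread window good {g = g} (joint-counts (s≤s z≤n) regular′ virtual-one) slack

  approxMagic : Connected G → ApproxMagic G top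
  approxMagic connected with euler (λ u v → walk-of-reach (connected u v)) even-degree Fin.zero
  ... | _ , _ , w , covers with long-run (g + g) Fin.zero (sym m≡) w covers
  ...   | _ , _ , _ , _ , _ , w′ , covers′ , real , len = circuit-approxMagic w′ covers′ real len

odd≢even : ∀ a b → suc (a + a) ≢ b + b
odd≢even zero    zero    ()
odd≢even zero    (suc b) eq with trans (suc-injective eq) (+-suc b b)
... | ()
odd≢even (suc a) zero    ()
odd≢even (suc a) (suc b) eq =
  odd≢even a b (suc-injective (trans (sym (cong suc (+-suc a a))) (trans (suc-injective eq) (+-suc b b))))

double-injective : ∀ {x y} → x + x ≡ y + y → x ≡ y
double-injective {x} {y} eq = *-cancelˡ-≡ x y 2 (trans (double x) (trans eq (sym (double y))))
  where
  double : ∀ x → 2 * x ≡ x + x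
  double = solve-∀

approxMagic-odd : ∀ {n top} (G : Graph n (suc top)) g → Connected G → Regular G (suc (g + g)) →
  n * suc (g + g) ≡ suc top + suc top → ApproxMagic G top
approxMagic-odd {n} {top} G g connected regular n*k≡ with parity n
... | odd q = ⊥-elim (odd≢even (g + q * suc (g + g)) (suc top) (trans (sym (odd-product q g)) n*k≡))
  where
  odd-product : ∀ q g → suc (q + q) * suc (g + g) ≡ suc ((g + q * suc (g + g)) + (g + q * suc (g + g)))
  odd-product = solve-∀
... | even zero     = ⊥-elim (0≢1+n n*k≡)
... | even (suc h′) = OddDegree.approxMagic G g regular
  (double-injective (trans (sym (*-distribʳ-+ (suc (g + g)) (suc h′) (suc h′))) n*k≡)) connected

theorem1p1 : ∀ {n m} (G : Graph n m) (k : ℕ) → 1 ≤ k → Connected G → Regular G k →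
    (k % 2 ≡ 1 → ApproxMagic G ((n * k) / 2 ∸ 1)) × (k % 2 ≡ 0 → ApproxMagic G k)
theorem1p1 {zero} G k _ _ _ = (λ _ → ↔⇒⤖ Perm.id , λ ()) , (λ _ → ↔⇒⤖ Perm.id , λ ())
theorem1p1 {suc n} {zero} G k 1≤k _ regular with subst (1 ≤_) (sym (regular Fin.zero)) 1≤k
... | ()
theorem1p1 {suc n} {suc top} G k _ connected regular = odd-part , even-part
  where
  nk≡m+m : suc n * k ≡ suc top + suc top
  nk≡m+m = trans (sym (trans (∑-cong (allFin (suc n)) regular) (∑-allFin-const (suc n) k))) (handshake G)

  odd-part : k % 2 ≡ 1 → ApproxMagic G ((suc n * k) / 2 ∸ 1)
  odd-part k-odd = subst (λ d → ApproxMagic G (d ∸ 1)) (sym half)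
    (approxMagic-odd G (k / 2) connected (subst (Regular G) k≡ regular) (subst (λ x → suc n * x ≡ suc top + suc top) k≡ nk≡m+m))
    where
    k≡ : k ≡ suc (k / 2 + k / 2)
    k≡ = trans (m≡m%n+[m/n]*n k 2) (trans (cong (_+ k / 2 * 2) k-odd) (cong suc (*-comm-double (k / 2))))
      where
      *-comm-double : ∀ x → x * 2 ≡ x + x
      *-comm-double = solve-∀
    half : (suc n * k) / 2 ≡ suc top
    half = trans (cong (_/ 2) (trans nk≡m+m (double (suc top)))) (m*n/n≡m (suc top) 2)
      where
      double : ∀ x → x + x ≡ x * 2
      double = solve-∀

  even-part : k % 2 ≡ 0 → ApproxMagic G k
  even-part k-even = subst (ApproxMagic G) (sym k≡) (EvenDegree.approxMagic G (k / 2) (subst (Regular G) k≡ regular) connected Fin.zero)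
    where
    k≡ : k ≡ 2 * (k / 2)
    k≡ = trans (m≡m%n+[m/n]*n k 2) (trans (cong (_+ k / 2 * 2) k-even) (*-comm (k / 2) 2))
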